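{- Let $G$ be a simple, biconnected, $k$-planar graph and let $\mathcal{T}$ be its SPQR-tree, rooted at a Q-node. Let $\mu$ be a node of $\mathcal{T}$ that is not the root, let $\mu'$ be its parent, and let $v$ be a pole of $\mu$. Then the degree of $v$ in the pertinent graph of $\mu$ is at most $k-2$ if $\mu'$ is a P-node or an R-node, and at most $k-1$ otherwise (i.e. if $\mu'$ is an S-node or a Q-node).
   Context: A $k$-planar graph is a planar graph in which every vertex has degree at most $k$. The SPQR-tree $\mathcal{T}$ of a biconnected graph $G$ (Di Battista–Tamassia) represents the decomposition of $G$ into triconnected components. Each node $\mu$ has a skeleton graph $\mathrm{skel}(\mu)$: for a Q-node it consists of two parallel edges between the same two vertices, one of which is a real edge of $G$; for an S-node it is a simple cycle of length at least three; for a P-node it is a bundle of at least three parallel edges between two vertices; for an R-node it is a simple triconnected graph. Skeleton edges that are not real are virtual; each virtual edge of $\mathrm{skel}(\mu)$ corresponds to a neighbor $\mu''$ of $\mu$ in $\mathcal{T}$ and to a twin virtual edge in $\mathrm{skel}(\mu'')$; Q-nodes are the leaves; no two S-nodes and no two P-nodes are adjacent. When $\mathcal{T}$ is rooted, every non-root node $\mu$ has exactly one virtual edge (the reference edge) whose twin lies in the skeleton of its parent; its endpoints $s,t$ are the poles of $\mu$. The pertinent graph of $\mu$ is the subgraph of $G$ obtained from $\mathrm{skel}(\mu)$ minus its reference edge by recursively replacing each virtual edge by the pertinent graph of the corresponding child (equivalently, the subgraph of $G$ formed by the real edges of the Q-nodes in the subtree rooted at $\mu$). -}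

module Defs where

open import Data.Nat using (ℕ; zero; suc; _+_; _≤_; _<_; _∸_)
import Data.Nat as ℕ
open import Data.Fin using (Fin; toℕ; fromℕ<; _≟_)
import Data.Fin as Fin
open import Data.Bool using (Bool; true; false; _∧_; _∨_; not; if_then_else_)
open import Data.Product using (Σ; _×_; _,_; proj₁; proj₂)
open import Data.Sum using (_⊎_)
open import Data.Unit using (⊤)
open import Data.Empty using (⊥)
open import Relation.Binary.PropositionalEquality using (_≡_; _≢_)
open import Relation.Nullary using (¬_; yes; no)
open import Relation.Nullary.Decidable using (⌊_⌋)

Inj : ∀ {A B : Set} → (A → B) → Set
Inj {A} f = ∀ (x y : A) → f x ≡ f y → x ≡ y

Surj : ∀ {A B : Set} → (A → B) → Set
Surj {A} {B} f = ∀ (y : B) → Σ A λ x → f x ≡ y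

ExactlyOne : {A : Set} → (A → Set) → Set
ExactlyOne {A} P = Σ A λ x → P x × (∀ y → P y → y ≡ x)

iter : {A : Set} → (A → A) → ℕ → A → A
iter f zero    x = x
iter f (suc i) x = f (iter f i x)

countF : ∀ {m} → (Fin m → Bool) → ℕ
countF {zero}  p = 0
countF {suc m} p = (if p Fin.zero then 1 else 0) + countF (λ i → p (Fin.suc i))

anyUpTo : ℕ → (ℕ → Bool) → Bool
anyUpTo zero    p = false
anyUpTo (suc k) p = p k ∨ anyUpTo k p

cycNext : ∀ {k} → Fin (suc k) → Fin (suc k)
cycNext {k} i with toℕ i ℕ.<? k
... | yes p = fromℕ< (ℕ.s≤s p)
... | no  _ = Fin.zero

-- (Multi)graphs on the vertex set Fin n: an edge i has end pair ends i.

Pair : ℕ → Set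
Pair n = Fin n × Fin n

_≈ₚ_ : ∀ {n} → Pair n → Pair n → Set
(a , b) ≈ₚ (c , d) = (a ≡ c × b ≡ d) ⊎ (a ≡ d × b ≡ c)

_∈ₚ_ : ∀ {n} → Fin n → Pair n → Set
v ∈ₚ (a , b) = v ≡ a ⊎ v ≡ b

data Walk {n E : ℕ} (ends : Fin E → Pair n) (ok : Fin n → Set) (a : Fin n) : Fin n → Set where
  here : Walk ends ok a a
  step : ∀ {b c} (i : Fin E) → Walk ends ok a b → ends i ≈ₚ (b , c) → ok c → Walk ends ok a c

-- v is a vertex of the multigraph (endpoint of some edge); used for skeletons
IsVertex : ∀ {n E} → (Fin E → Pair n) → Fin n → Set
IsVertex {E = E} ends v = Σ (Fin E) λ i → v ∈ₚ ends i

ConnectedOn : ∀ {n E} → (Fin n → Set) → (Fin E → Pair n) → (Fin n → Set) → Set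
ConnectedOn V ends ok = ∀ a b → V a → V b → ok a → ok b → Walk ends ok a b

SimpleEdges : ∀ {n E} → (Fin E → Pair n) → Set
SimpleEdges ends = (∀ e → proj₁ (ends e) ≢ proj₂ (ends e))
                 × (∀ e e' → ends e ≈ₚ ends e' → e ≡ e')

AllV : ∀ {n} → Fin n → Set
AllV _ = ⊤

Biconnected : ∀ {n m} → (Fin m → Pair n) → Set
Biconnected {n} ends = (3 ≤ n)
  × ConnectedOn AllV ends AllV
  × (∀ (x : Fin n) → ConnectedOn AllV ends (λ c → c ≢ x))

incident : ∀ {n m} → (Fin m → Pair n) → Fin n → Fin m → Bool
incident ends v e = ⌊ v ≟ proj₁ (ends e) ⌋ ∨ ⌊ v ≟ proj₂ (ends e) ⌋

degIn : ∀ {n m} → (Fin m → Pair n) → (Fin m → Bool) → Fin n → ℕ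
degIn ends S v = countF (λ e → incident ends v e ∧ S e)

deg : ∀ {n m} → (Fin m → Pair n) → Fin n → ℕ
deg ends v = degIn ends (λ _ → true) v

-- Planarity via combinatorial embeddings (rotation systems).
Dart : ℕ → Set
Dart m = Fin m × Bool

tail : ∀ {n m} → (Fin m → Pair n) → Dart m → Fin n
tail ends (e , false) = proj₁ (ends e)
tail ends (e , true)  = proj₂ (ends e)

rev : ∀ {m} → Dart m → Dart m
rev (e , b) = (e , not b)

record RotationSystem {n m : ℕ} (ends : Fin m → Pair n) : Set where
  field
    σ       : Dart m → Dart m
    σ-inj   : Inj σ
    σ-tail  : ∀ d → tail ends (σ d) ≡ tail ends d
    σ-cyclic : ∀ d d' → tail ends d ≡ tail ends d' → Σ ℕ λ i → iter σ i d ≡ d'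
  φ : Dart m → Dart m
  φ d = σ (rev d)

HasFaces : ∀ {n m} {ends : Fin m → Pair n} → RotationSystem ends → ℕ → Set
HasFaces {m = m} ρ F = Σ (Dart m → Fin F) λ f → Surj f
  × (∀ d d' → f d ≡ f d' → Σ ℕ λ i → iter (RotationSystem.φ ρ) i d ≡ d')
  × (∀ d d' → (Σ ℕ λ i → iter (RotationSystem.φ ρ) i d ≡ d') → f d ≡ f d')

-- planar (for connected graphs): has a rotation system of genus 0, V - E + F = 2
Planar : ∀ {n m} → (Fin m → Pair n) → Set
Planar {n} {m} ends = Σ (RotationSystem ends) λ ρ → Σ ℕ λ F → HasFaces ρ F × (n + F ≡ m + 2)

KPlanar : ∀ {n m} → ℕ → (Fin m → Pair n) → Set
KPlanar {n} k ends = Planar ends × (∀ (v : Fin n) → deg ends v ≤ k)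

-- Skeleton edge labels: a real edge of G, the reference edge (twin in
-- the parent's skeleton), or the virtual edge whose twin is the
-- reference edge of the child ν.

data Label (N m : ℕ) : Set where
  real : Fin m → Label N m
  up   : Label N m
  down : Fin N → Label N m

IsVirtual : ∀ {N m} → Label N m → Set
IsVirtual (real _) = ⊥
IsVirtual up       = ⊤
IsVirtual (down _) = ⊤

data Kind : Set where
  S P Q R : Kind

module _ {n m N E : ℕ} (lab : Fin E → Label N m) (ends : Fin E → Pair n) where

  AllVirtual : Set
  AllVirtual = ∀ i → IsVirtual (lab i)

  QSkel : Set
  QSkel = (E ≡ 2) × Σ (Fin E) λ i → Σ (Fin E) λ j → i ≢ j
        × (Σ (Fin m) λ e → lab i ≡ real e) × IsVirtual (lab j) × (ends i ≈ₚ ends j)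

  SSkel : Set
  SSkel = AllVirtual × Σ ℕ λ L → Σ (Fin (suc (suc (suc L))) → Fin n) λ w → Inj w
        × Σ (Fin (suc (suc (suc L))) → Fin E) λ π → Inj π × Surj π
        × (∀ i → ends (π i) ≈ₚ (w i , w (cycNext i)))

  PSkel : Set
  PSkel = AllVirtual × (3 ≤ E) × Σ (Fin n) λ u → Σ (Fin n) λ v → u ≢ v
        × (∀ i → ends i ≈ₚ (u , v))

  -- simple triconnected graph: ≥ 4 vertices, connected after removing
  -- any at most two vertices
  RSkel : Set
  RSkel = AllVirtual × SimpleEdges ends
        × (Σ (Fin 4 → Fin n) λ f → Inj f × (∀ i → IsVertex ends (f i)))
        × ConnectedOn (IsVertex ends) ends AllV
        × (∀ x y → ConnectedOn (IsVertex ends) ends (λ c → c ≢ x × c ≢ y))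

  SkelOK : Kind → Set
  SkelOK S = SSkel
  SkelOK P = PSkel
  SkelOK Q = QSkel
  SkelOK R = RSkel

record SPQRTree {n m : ℕ} (Gends : Fin m → Pair n) : Set where
  field
    N        : ℕ
    root     : Fin N
    par      : Fin N → Fin N
    par-root : par root ≡ root
    rank     : Fin N → ℕ
    rank-par : ∀ ν → ν ≢ root → rank (par ν) < rank ν
    kind     : Fin N → Kind
    ec       : Fin N → ℕ
    lab      : (μ : Fin N) → Fin (ec μ) → Label N m
    ends     : (μ : Fin N) → Fin (ec μ) → Pair n
    skel-ok  : ∀ μ → SkelOK (lab μ) (ends μ) (kind μ)
    no-SS    : ∀ ν → ν ≢ root → kind ν ≡ S → kind (par ν) ≡ S → ⊥
    no-PP    : ∀ ν → ν ≢ root → kind ν ≡ P → kind (par ν) ≡ P → ⊥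
    up-root     : ∀ i → lab root i ≢ up
    up-unique   : ∀ μ → μ ≢ root → ExactlyOne (λ i → lab μ i ≡ up)
    down-child  : ∀ μ i ν → lab μ i ≡ down ν → (ν ≢ root) × (par ν ≡ μ)
    down-unique : ∀ ν → ν ≢ root → ExactlyOne (λ i → lab (par ν) i ≡ down ν)
    twin        : ∀ ν i j → lab (par ν) i ≡ down ν → lab ν j ≡ up
                  → ends (par ν) i ≈ₚ ends ν j
    real-ends   : ∀ μ i e → lab μ i ≡ real e → ends μ i ≈ₚ Gends e
    real-unique : ∀ e → ExactlyOne {Σ (Fin N) λ μ → Fin (ec μ)}
                          (λ p → lab (proj₁ p) (proj₂ p) ≡ real e)
    -- gluing: adjacent skeletons share exactly the poles,
    share : ∀ ν v → ν ≢ root → IsVertex (ends ν) v → IsVertex (ends (par ν)) v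
            → Σ (Fin (ec ν)) λ j → lab ν j ≡ up × v ∈ₚ ends ν j
    -- and the nodes containing a vertex v form a subtree (unique top node)
    subtree : ∀ v μ₁ μ₂
            → IsVertex (ends μ₁) v × (μ₁ ≡ root ⊎ ¬ IsVertex (ends (par μ₁)) v)
            → IsVertex (ends μ₂) v × (μ₂ ≡ root ⊎ ¬ IsVertex (ends (par μ₂)) v)
            → μ₁ ≡ μ₂

module _ {n m : ℕ} {Gends : Fin m → Pair n} (T : SPQRTree Gends) where
  open SPQRTree T

  IsPole : Fin N → Fin n → Set
  IsPole μ v = Σ (Fin (ec μ)) λ j → lab μ j ≡ up × v ∈ₚ ends μ j

  home : Fin m → Fin N
  home e = proj₁ (proj₁ (real-unique e))

  isDesc : Fin N → Fin N → Bool
  isDesc ν μ = anyUpTo (suc N) (λ i → ⌊ iter par i ν ≟ μ ⌋)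

  -- edge set of the pertinent graph of μ
  inPert : Fin N → Fin m → Bool
  inPert μ e = isDesc (home e) μ

poleBound : ℕ → Kind → ℕ
poleBound k S = k ∸ 1
poleBound k Q = k ∸ 1
poleBound k P = k ∸ 2
poleBound k R = k ∸ 2

-- Let μ′ be the parent of μ and i₀ the edge of skel(μ′) standing for μ.  In skel(μ′) the pole v
-- lies on at least one further edge if μ′ is an S- or Q-node (a cycle; two parallel edges) and
-- on at least two if μ′ is a P- or R-node (≥ 3 parallel edges; a triconnected graph).  Every
-- skeleton edge of μ′ at v is realised by an edge of G at v: itself if real, an edge of the
-- child's pertinent graph if it stands for a child, an edge outside the subtree of μ′ if it is
-- the reference edge.  Distinct skeleton edges represent disjoint parts of G, so v has 1
-- (resp. 2) edges of G outside the pertinent graph of μ, and deg v ≤ k gives the bound.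
module Submission where

open import Defs
open import Data.Nat using (ℕ; zero; suc; _+_; _≤_; _<_; _∸_; z≤n; s≤s)
import Data.Nat as ℕ
open import Data.Nat.Properties
  using (≤-refl; ≤-trans; ≤-reflexive; <⇒≤; <-irrefl; ≤-<-trans; <-≤-trans; +-mono-≤; +-monoˡ-≤;
         +-suc; +-identityʳ; +-comm; m≤n⇒∃[o]m+o≡n; ≤-total; m+n≤o⇒m≤o∸n; 1+n≢n; n<1+n; module ≤-Reasoning)
open import Data.Nat.Induction using (<-wellFounded)
open import Induction.WellFounded using (Acc; acc)
open import Data.Fin using (Fin; zero; suc; toℕ; fromℕ; inject₁; _≟_)
import Data.Fin.Properties as Fin
open import Data.Bool using (Bool; true; false; T; _∧_; _∨_; if_then_else_)
open import Data.Bool.Properties using (T-∧; T-∨)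
open import Data.List using (List; []; _∷_; length; lookup)
open import Data.List.Relation.Unary.Any using (here; there; index)
open import Data.List.Relation.Unary.Any.Properties using (lookup-index)
open import Data.List.Membership.Propositional using (_∈_; _∉_)
import Data.List.Membership.DecPropositional as DecMembership
open import Data.Product using (Σ; ∃; ∃₂; _×_; _,_; proj₁; proj₂)
open import Data.Product.Properties using (,-injectiveʳ-UIP)
open import Data.Sum using (_⊎_; inj₁; inj₂; [_,_]; [_,_]′)
open import Data.Unit using (tt)
open import Data.Empty using (⊥-elim)
open import Function using (_∘_)
open import Function.Bundles using (Equivalence; _⇔_)
open import Axiom.UniquenessOfIdentityProofs using (module Decidable⇒UIP)
open import Relation.Binary.PropositionalEquality using (_≡_; _≢_; refl; sym; trans; cong; subst)
open import Relation.Nullary using (¬_; yes; no)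
open import Relation.Nullary.Decidable using (⌊_⌋; toWitness; fromWitness)

open Equivalence using (to; from)

_⊆ᵇ_ : ∀ {m} → (Fin m → Bool) → (Fin m → Bool) → Set
p ⊆ᵇ q = ∀ x → T (p x) → T (q x)

indicator-mono : ∀ {a b} → (T a → T b) → (if a then 1 else 0) ≤ (if b then 1 else 0)
indicator-mono {true}  {true}  _   = ≤-refl
indicator-mono {true}  {false} a⇒b = ⊥-elim (a⇒b tt)
indicator-mono {false}         _   = z≤n

indicator-< : ∀ {a b} → ¬ T a → T b → suc (if a then 1 else 0) ≤ (if b then 1 else 0)
indicator-< {true}         ¬a _ = ⊥-elim (¬a tt)
indicator-< {false} {true} _  _ = ≤-refl

countF-mono : ∀ {m} {p q : Fin m → Bool} → p ⊆ᵇ q → countF p ≤ countF q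
countF-mono {zero}  _   = z≤n
countF-mono {suc m} p⊆q = +-mono-≤ (indicator-mono (p⊆q zero)) (countF-mono (p⊆q ∘ suc))

countF-< : ∀ {m} {p q : Fin m → Bool} → p ⊆ᵇ q
         → ∀ e → T (q e) → ¬ T (p e) → suc (countF p) ≤ countF q
countF-< {suc m} p⊆q zero    qe ¬pe = +-mono-≤ (indicator-< ¬pe qe) (countF-mono (p⊆q ∘ suc))
countF-< {suc m} p⊆q (suc e) qe ¬pe =
  ≤-trans (≤-reflexive (sym (+-suc _ _)))
          (+-mono-≤ (indicator-mono (p⊆q zero)) (countF-< (p⊆q ∘ suc) e qe ¬pe))

countF-+-injection : ∀ {m c} {p q : Fin m → Bool} → p ⊆ᵇ q
                   → (f : Fin c → Fin m) → Inj f → (∀ t → T (q (f t)) × ¬ T (p (f t)))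
                   → countF p + c ≤ countF q
countF-+-injection {c = zero} {p} p⊆q _ _ _ =
  ≤-trans (≤-reflexive (+-identityʳ (countF p))) (countF-mono p⊆q)
countF-+-injection {c = suc c} {p} {q} p⊆q f f-inj f-new = begin
  countF p + suc c    ≡⟨ +-suc (countF p) c ⟩
  suc (countF p) + c  ≤⟨ +-monoˡ-≤ c (countF-< p⊆p⁺ (f zero) f₀∈p⁺ (proj₂ (f-new zero))) ⟩
  countF p⁺ + c       ≤⟨ countF-+-injection p⁺⊆q (f ∘ suc) f∘suc-inj f∘suc-new ⟩
  countF q            ∎
  where
  open ≤-Reasoning
  p⁺ : Fin _ → Bool
  p⁺ x = p x ∨ ⌊ x ≟ f zero ⌋
  T-p⁺ : ∀ x → T (p⁺ x) ⇔ (T (p x) ⊎ T ⌊ x ≟ f zero ⌋)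
  T-p⁺ x = T-∨ {p x} {⌊ x ≟ f zero ⌋}
  p⊆p⁺ : p ⊆ᵇ p⁺
  p⊆p⁺ x = from (T-p⁺ x) ∘ inj₁
  f₀∈p⁺ : T (p⁺ (f zero))
  f₀∈p⁺ = from (T-p⁺ (f zero)) (inj₂ (fromWitness refl))
  p⁺⊆q : p⁺ ⊆ᵇ q
  p⁺⊆q x h with to (T-p⁺ x) h
  ... | inj₁ px = p⊆q x px
  ... | inj₂ x≡f₀ rewrite toWitness x≡f₀ = proj₁ (f-new zero)
  f∘suc-inj : Inj (f ∘ suc)
  f∘suc-inj s t = Fin.suc-injective ∘ f-inj (suc s) (suc t)
  f∘suc-new : ∀ t → T (q (f (suc t))) × ¬ T (p⁺ (f (suc t)))
  f∘suc-new t =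
    proj₁ (f-new (suc t)) , [ proj₂ (f-new (suc t)) , (λ ()) ∘ f-inj _ _ ∘ toWitness ] ∘ to (T-p⁺ _)

∈ₚ⇒incident : ∀ {n m} (G : Fin m → Pair n) {a} e → a ∈ₚ G e → T (incident G a e)
∈ₚ⇒incident G {a} e a∈ with a ≟ proj₁ (G e) | a ≟ proj₂ (G e) | a∈
... | yes _  | _     | _        = tt
... | no  _  | yes _ | _        = tt
... | no  ¬l | no ¬r | inj₁ a≡l = ¬l a≡l
... | no  ¬l | no ¬r | inj₂ a≡r = ¬r a≡r

degIn-+-outside : ∀ {n m c} (G : Fin m → Pair n) (keep : Fin m → Bool) v
                → (f : Fin c → Fin m) → Inj f → (∀ t → T (incident G v (f t)) × ¬ T (keep (f t)))
                → degIn G keep v + c ≤ deg G v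
degIn-+-outside G keep v f f-inj f-out =
  countF-+-injection kept⊆all f f-inj (λ t → from (T-at (f t) true) (proj₁ (f-out t) , tt)
                                          , proj₂ (f-out t) ∘ proj₂ ∘ to (T-at (f t) (keep (f t))))
  where
  T-at : ∀ e b → T (incident G v e ∧ b) ⇔ (T (incident G v e) × T b)
  T-at e b = T-∧ {incident G v e} {b}
  kept⊆all : (λ e → incident G v e ∧ keep e) ⊆ᵇ (λ e → incident G v e ∧ true)
  kept⊆all e = from (T-at e true) ∘ (_, tt) ∘ proj₁ ∘ to (T-at e (keep e))

Fin2-≢-≢⇒≡ : ∀ (i j k : Fin 2) → i ≢ j → i ≢ k → j ≡ k
Fin2-≢-≢⇒≡ zero       zero       _          i≢j _   = ⊥-elim (i≢j refl)
Fin2-≢-≢⇒≡ zero       (suc zero) zero       _   i≢k = ⊥-elim (i≢k refl)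
Fin2-≢-≢⇒≡ zero       (suc zero) (suc zero) _   _   = refl
Fin2-≢-≢⇒≡ (suc zero) zero       zero       _   _   = refl
Fin2-≢-≢⇒≡ (suc zero) zero       (suc zero) _   i≢k = ⊥-elim (i≢k refl)
Fin2-≢-≢⇒≡ (suc zero) (suc zero) _          i≢j _   = ⊥-elim (i≢j refl)

two-indices-besides : ∀ {E} → 3 ≤ E → (j : Fin E) → ∃₂ λ i₁ i₂ → i₁ ≢ j × i₂ ≢ j × i₁ ≢ i₂
two-indices-besides {suc zero}       (s≤s ())       _
two-indices-besides {suc (suc zero)} (s≤s (s≤s ())) _
two-indices-besides {suc (suc (suc _))} _ zero             = suc zero , suc (suc zero) , (λ ()) , (λ ()) , λ ()
two-indices-besides {suc (suc (suc _))} _ (suc zero)       = zero , suc (suc zero) , (λ ()) , (λ ()) , λ ()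
two-indices-besides {suc (suc (suc _))} _ (suc (suc _))    = zero , suc zero , (λ ()) , (λ ()) , λ ()

injection-avoids : ∀ {n} (xs : List (Fin n)) (f : Fin (suc (length xs)) → Fin n) → Inj f
                 → ∃ λ t → f t ∉ xs
injection-avoids xs f f-inj = Fin.¬∀⟶∃¬ _ (λ t → f t ∈ xs) (λ t → DecMembership._∈?_ _≟_ (f t) xs) not-all-in
  where
  not-all-in : ¬ (∀ t → f t ∈ xs)
  not-all-in f∈ with Fin.pigeonhole (n<1+n (length xs)) (index ∘ f∈)
  ... | i , j , i<j , same-index =
    Fin.<-irrefl (f-inj i j (trans (lookup-index (f∈ i))
                            (trans (cong (lookup xs) same-index) (sym (lookup-index (f∈ j)))))) i<j

cycNext-surjective : ∀ {k} (t : Fin (suc k)) → ∃ λ s → cycNext s ≡ t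
cycNext-surjective {k} zero = fromℕ k , last↦zero
  where
  last↦zero : cycNext (fromℕ k) ≡ zero
  last↦zero with toℕ (fromℕ k) ℕ.<? k
  ... | yes k<k = ⊥-elim (<-irrefl (Fin.toℕ-fromℕ k) k<k)
  ... | no _    = refl
cycNext-surjective {suc k} (suc t) = inject₁ t , inject₁↦suc
  where
  inject₁↦suc : cycNext (inject₁ t) ≡ suc t
  inject₁↦suc with toℕ (inject₁ t) ℕ.<? suc k
  ... | yes t<k = Fin.toℕ-injective (trans (Fin.toℕ-fromℕ< (s≤s t<k)) (cong suc (Fin.toℕ-inject₁ t)))
  ... | no  t≮k = ⊥-elim (t≮k (subst (_< suc k) (sym (Fin.toℕ-inject₁ t)) (Fin.toℕ<n t)))

cycNext-≢ : ∀ {k} (t : Fin (suc (suc k))) → cycNext t ≢ t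
cycNext-≢ {k} t eq with toℕ t ℕ.<? suc k
cycNext-≢ t       eq | yes t<k = 1+n≢n (trans (sym (Fin.toℕ-fromℕ< (s≤s t<k))) (cong toℕ eq))
cycNext-≢ zero    eq | no  t≮k = t≮k (s≤s z≤n)
cycNext-≢ (suc t) () | no  _

∈ₚ-resp-≈ₚ : ∀ {n} {a : Fin n} {p q : Pair n} → a ∈ₚ p → p ≈ₚ q → a ∈ₚ q
∈ₚ-resp-≈ₚ (inj₁ refl) (inj₁ (refl , refl)) = inj₁ refl
∈ₚ-resp-≈ₚ (inj₁ refl) (inj₂ (refl , refl)) = inj₂ refl
∈ₚ-resp-≈ₚ (inj₂ refl) (inj₁ (refl , refl)) = inj₂ refl
∈ₚ-resp-≈ₚ (inj₂ refl) (inj₂ (refl , refl)) = inj₁ refl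

≈ₚ-sym : ∀ {n} {p q : Pair n} → p ≈ₚ q → q ≈ₚ p
≈ₚ-sym (inj₁ (refl , refl)) = inj₁ (refl , refl)
≈ₚ-sym (inj₂ (refl , refl)) = inj₂ (refl , refl)

otherEnd : ∀ {n} {a : Fin n} {p : Pair n} → a ∈ₚ p → ∃ λ x → p ≈ₚ (a , x)
otherEnd {p = _ , b} (inj₁ refl) = b , inj₁ (refl , refl)
otherEnd {p = b , _} (inj₂ refl) = b , inj₂ (refl , refl)

≈ₚ-loopless : ∀ {n} {p : Pair n} {a b} → proj₁ p ≢ proj₂ p → p ≈ₚ (a , b) → a ≢ b
≈ₚ-loopless p₁≢p₂ (inj₁ (refl , refl)) = p₁≢p₂
≈ₚ-loopless p₁≢p₂ (inj₂ (refl , refl)) = p₁≢p₂ ∘ sym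

≈ₚ-otherEnd-unique : ∀ {n} {p : Pair n} {a c c′} → proj₁ p ≢ proj₂ p
                   → p ≈ₚ (a , c) → p ≈ₚ (a , c′) → c ≡ c′
≈ₚ-otherEnd-unique _       (inj₁ (refl , refl)) (inj₁ (refl , refl)) = refl
≈ₚ-otherEnd-unique p₁≢p₂ (inj₁ (refl , refl)) (inj₂ (refl , refl)) = ⊥-elim (p₁≢p₂ refl)
≈ₚ-otherEnd-unique p₁≢p₂ (inj₂ (refl , refl)) (inj₁ (refl , refl)) = ⊥-elim (p₁≢p₂ refl)
≈ₚ-otherEnd-unique _       (inj₂ (refl , refl)) (inj₂ (refl , refl)) = refl

walk-leaves : ∀ {n E} {ends : Fin E → Pair n} {ok : Fin n → Set} {a c}
            → Walk ends ok a c → a ≢ c → ∃₂ λ i c₁ → ends i ≈ₚ (a , c₁) × ok c₁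
walk-leaves here                    a≢c = ⊥-elim (a≢c refl)
walk-leaves {a = a} (step {b = b} {c = c} i w i≈bc ok-c) a≢c with a ≟ b
... | yes refl = i , c , i≈bc , ok-c
... | no  a≢b  = walk-leaves w a≢b

OtherEdgesAt : ∀ {n E} → (Fin E → Pair n) → Fin E → Fin n → ℕ → Set
OtherEdgesAt {E = E} ends j a c = Σ (Fin c → Fin E) λ f → Inj f × (∀ t → f t ≢ j × a ∈ₚ ends (f t))

otherEdgesAtPole : Kind → ℕ
otherEdgesAtPole S = 1
otherEdgesAtPole Q = 1
otherEdgesAtPole P = 2
otherEdgesAtPole R = 2

firstOther : ∀ κ → Fin (otherEdgesAtPole κ)
firstOther S = zero
firstOther Q = zero
firstOther P = zero
firstOther R = zero

poleBound≡∸ : ∀ k κ → poleBound k κ ≡ k ∸ otherEdgesAtPole κ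
poleBound≡∸ k S = refl
poleBound≡∸ k Q = refl
poleBound≡∸ k P = refl
poleBound≡∸ k R = refl

module OtherEdges {n E} (ends : Fin E → Pair n) {j : Fin E} {a : Fin n} where

  other-edges₁ : ∀ {i} → i ≢ j → a ∈ₚ ends i → OtherEdgesAt ends j a 1
  other-edges₁ {i} i≢j a∈i = (λ _ → i) , (λ { zero zero _ → refl }) , λ _ → i≢j , a∈i

  other-edges₂ : ∀ {i₁ i₂} → i₁ ≢ j → i₂ ≢ j → i₁ ≢ i₂ → a ∈ₚ ends i₁ → a ∈ₚ ends i₂
                → OtherEdgesAt ends j a 2
  other-edges₂ {i₁} {i₂} i₁≢j i₂≢j i₁≢i₂ a∈i₁ a∈i₂ = pick , pick-inj , at
    where
    pick : Fin 2 → Fin E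
    pick zero    = i₁
    pick (suc _) = i₂
    pick-inj : Inj pick
    pick-inj zero          zero          _  = refl
    pick-inj zero          (suc zero)    eq = ⊥-elim (i₁≢i₂ eq)
    pick-inj (suc zero)    zero          eq = ⊥-elim (i₁≢i₂ (sym eq))
    pick-inj (suc zero)    (suc zero)    _  = refl
    at : ∀ t → pick t ≢ j × a ∈ₚ ends (pick t)
    at zero    = i₁≢j , a∈i₁
    at (suc _) = i₂≢j , a∈i₂

module _ {n m N E} {lab : Fin E → Label N m} {ends : Fin E → Pair n} {j : Fin E} {a : Fin n} where
  open OtherEdges ends

  Q-others : QSkel lab ends → IsVirtual (lab j) → a ∈ₚ ends j → OtherEdgesAt ends j a 1
  Q-others (refl , i , i′ , i≢i′ , (_ , i-real) , _ , i≈i′) j-virtual a∈j =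
    other-edges₁ i≢j (∈ₚ-resp-≈ₚ (subst (λ z → a ∈ₚ ends z) (sym (Fin2-≢-≢⇒≡ i i′ j i≢i′ i≢j)) a∈j) (≈ₚ-sym i≈i′))
    where
    i≢j : i ≢ j
    i≢j refl = subst IsVirtual i-real j-virtual

  -- In the cycle w₀ w₁ … the edge π t joins w t to w (cycNext t); the other edge at w t is
  -- the edge before it, the other edge at w (cycNext t) the edge after it.
  S-others : SSkel lab ends → a ∈ₚ ends j → OtherEdgesAt ends j a 1
  S-others (_ , _ , w , _ , π , π-inj , π-surj , π-ends) a∈j with π-surj j
  ... | t , refl with ∈ₚ-resp-≈ₚ a∈j (π-ends t)
  ... | inj₂ refl =
    other-edges₁ (cycNext-≢ t ∘ π-inj (cycNext t) t) (∈ₚ-resp-≈ₚ (inj₁ refl) (≈ₚ-sym (π-ends (cycNext t))))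
  ... | inj₁ refl with cycNext-surjective t
  ... | s , s↦t =
    other-edges₁ (λ eq → cycNext-≢ t (trans (cong cycNext (sym (π-inj s t eq))) s↦t))
              (∈ₚ-resp-≈ₚ (inj₂ (cong w (sym s↦t))) (≈ₚ-sym (π-ends s)))

  P-others : PSkel lab ends → a ∈ₚ ends j → OtherEdgesAt ends j a 2
  P-others (_ , 3≤E , _ , _ , _ , bundle) a∈j with two-indices-besides 3≤E j
  ... | i₁ , i₂ , i₁≢j , i₂≢j , i₁≢i₂ = other-edges₂ i₁≢j i₂≢j i₁≢i₂ (at i₁) (at i₂)
    where
    at : ∀ i → a ∈ₚ ends i
    at i = ∈ₚ-resp-≈ₚ (∈ₚ-resp-≈ₚ a∈j (bundle j)) (≈ₚ-sym (bundle i))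

  -- With x the other end of j, deleting {x, y} leaves a connected graph containing a and a
  -- fourth vertex; the first step of a walk between them leaves a avoiding x and y.  Doing
  -- this for y = x and then for y = the neighbour found gives two further edges at a.
  R-others : RSkel lab ends → a ∈ₚ ends j → OtherEdgesAt ends j a 2
  R-others (_ , (loopless , _) , (f , f-inj , f-vertex) , _ , connected₂) a∈j =
    let i₁ , c₁ , e₁ , c₁≢x , _     = leave-avoiding x a≢x
        i₂ , c₂ , e₂ , c₂≢x , c₂≢c₁ = leave-avoiding c₁ (≈ₚ-loopless (loopless i₁) e₁)
    in other-edges₂ (distinct e₁ j≈ax c₁≢x) (distinct e₂ j≈ax c₂≢x) (distinct e₁ e₂ (c₂≢c₁ ∘ sym))
                    (∈ₚ-resp-≈ₚ (inj₁ refl) (≈ₚ-sym e₁)) (∈ₚ-resp-≈ₚ (inj₁ refl) (≈ₚ-sym e₂))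
    where
    x = proj₁ (otherEnd a∈j)
    j≈ax = proj₂ (otherEnd a∈j)
    a≢x = ≈ₚ-loopless (loopless j) j≈ax

    leave-avoiding : ∀ y → a ≢ y → ∃₂ λ i c → ends i ≈ₚ (a , c) × c ≢ x × c ≢ y
    leave-avoiding y a≢y with injection-avoids (a ∷ x ∷ y ∷ []) f f-inj
    ... | t , ft∉ =
      walk-leaves (connected₂ x y a (f t) (j , a∈j) (f-vertex t) (a≢x , a≢y)
                              (ft∉ ∘ there ∘ here , ft∉ ∘ there ∘ there ∘ here))
                  (ft∉ ∘ here ∘ sym)

    distinct : ∀ {i i′ c c′} → ends i ≈ₚ (a , c) → ends i′ ≈ₚ (a , c′) → c ≢ c′ → i ≢ i′
    distinct {i} i≈ac i′≈ac′ c≢c′ refl = c≢c′ (≈ₚ-otherEnd-unique (loopless i) i≈ac i′≈ac′)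

  skeleton-others : ∀ κ → SkelOK lab ends κ → IsVirtual (lab j) → a ∈ₚ ends j
                  → OtherEdgesAt ends j a (otherEdgesAtPole κ)
  skeleton-others S sk _         = S-others sk
  skeleton-others Q sk j-virtual = Q-others sk j-virtual
  skeleton-others P sk _         = P-others sk
  skeleton-others R sk _         = R-others sk

ExactlyOne-unique : ∀ {A : Set} {P : A → Set} → ExactlyOne P → ∀ {x y} → P x → P y → x ≡ y
ExactlyOne-unique (_ , _ , unique) px py = trans (unique _ px) (sym (unique _ py))

iter-suc : ∀ {A : Set} (f : A → A) i x → iter f (suc i) x ≡ iter f i (f x)
iter-suc f zero    x = refl
iter-suc f (suc i) x = cong f (iter-suc f i x)

iter-+ : ∀ {A : Set} (f : A → A) i j x → iter f (i + j) x ≡ iter f i (iter f j x)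
iter-+ f zero    j x = refl
iter-+ f (suc i) j x = cong f (iter-+ f i j x)

anyUpTo-sound : ∀ K (p : ℕ → Bool) → T (anyUpTo K p) → ∃ λ i → T (p i)
anyUpTo-sound (suc K) p h = [ (K ,_) , anyUpTo-sound K p ]′ (to (T-∨ {p K}) h)

module _ {n m} {G : Fin m → Pair n} (𝒯 : SPQRTree G) where
  open SPQRTree 𝒯

  Descendant : Fin N → Fin N → Set
  Descendant x μ = ∃ λ i → iter par i x ≡ μ

  descendant-par : ∀ {x ν} → Descendant x ν → Descendant x (par ν)
  descendant-par (i , p) = suc i , cong par p

  rank-par-≤ : ∀ ν → rank (par ν) ≤ rank ν
  rank-par-≤ ν with ν ≟ root
  ... | yes refl rewrite par-root = ≤-refl
  ... | no  ν≢root = <⇒≤ (rank-par ν ν≢root)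

  rank-descendant : ∀ {x μ} → Descendant x μ → rank μ ≤ rank x
  rank-descendant (zero  , refl) = ≤-refl
  rank-descendant (suc i , refl) = ≤-trans (rank-par-≤ _) (rank-descendant (i , refl))

  par-not-descendant : ∀ {ν} → ν ≢ root → ¬ Descendant (par ν) ν
  par-not-descendant ν≢root d = <-irrefl refl (≤-<-trans (rank-descendant d) (rank-par _ ν≢root))

  iter-descendant : ∀ x {i j} → i ≤ j → Descendant (iter par i x) (iter par j x)
  iter-descendant x {i} i≤j with m≤n⇒∃[o]m+o≡n i≤j
  ... | o , refl = o , trans (sym (iter-+ par o i x)) (cong (λ l → iter par l x) (+-comm o i))

  descendants-chain : ∀ {x ν₁ ν₂} → Descendant x ν₁ → Descendant x ν₂
                    → Descendant ν₁ ν₂ ⊎ Descendant ν₂ ν₁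
  descendants-chain {x} (i , refl) (j , refl) with ≤-total i j
  ... | inj₁ i≤j = inj₁ (iter-descendant x i≤j)
  ... | inj₂ j≤i = inj₂ (iter-descendant x j≤i)

  sibling-descendant : ∀ {ν₁ ν₂} → ν₂ ≢ root → par ν₁ ≡ par ν₂ → Descendant ν₁ ν₂ → ν₁ ≡ ν₂
  sibling-descendant _       _    (zero  , ν₁≡ν₂) = ν₁≡ν₂
  sibling-descendant ν₂≢root same (suc d , p) =
    ⊥-elim (par-not-descendant ν₂≢root (subst (λ z → Descendant z _) same (d , trans (sym (iter-suc par d _)) p)))

  siblings-disjoint : ∀ {x ν₁ ν₂} → ν₁ ≢ root → ν₂ ≢ root → par ν₁ ≡ par ν₂ → ν₁ ≢ ν₂
                    → Descendant x ν₁ → ¬ Descendant x ν₂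
  siblings-disjoint ν₁≢root ν₂≢root same ν₁≢ν₂ d₁ d₂ with descendants-chain d₁ d₂
  ... | inj₁ d = ν₁≢ν₂ (sibling-descendant ν₂≢root same d)
  ... | inj₂ d = ν₁≢ν₂ (sym (sibling-descendant ν₁≢root (sym same) d))

  inPert-sound : ∀ μ e → T (inPert 𝒯 μ e) → Descendant (home 𝒯 e) μ
  inPert-sound μ e h with anyUpTo-sound (suc N) (λ i → ⌊ iter par i (home 𝒯 e) ≟ μ ⌋) h
  ... | i , w = i , toWitness w

  home-real : ∀ {μ i e} → lab μ i ≡ real e → home 𝒯 e ≡ μ
  home-real {μ} {i} {e} li = cong proj₁ (sym (proj₂ (proj₂ (real-unique e)) (μ , i) li))

  up-not-root : ∀ {μ i} → lab μ i ≡ up → μ ≢ root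
  up-not-root {i = i} li refl = up-root i li

  up-virtual : ∀ {l : Label N m} → l ≡ up → IsVirtual l
  up-virtual refl = tt

  down-virtual : ∀ {l : Label N m} {ν} → l ≡ down ν → IsVirtual l
  down-virtual refl = tt

  up-index-unique : ∀ {μ i₁ i₂} → lab μ i₁ ≡ up → lab μ i₂ ≡ up → i₁ ≡ i₂
  up-index-unique l₁ l₂ = ExactlyOne-unique (up-unique _ (up-not-root l₁)) l₁ l₂

  down-index-unique : ∀ {μ i₁ i₂ ν} → lab μ i₁ ≡ down ν → lab μ i₂ ≡ down ν → i₁ ≡ i₂
  down-index-unique {μ} {i₁} {ν = ν} l₁ l₂ with down-child μ i₁ ν l₁
  ... | ν≢root , refl = ExactlyOne-unique (down-unique ν ν≢root) l₁ l₂

  -- real-unique gives (μ , i₁) ≡ (μ , i₂); projecting to i₁ ≡ i₂ needs UIP, which Fin has.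
  real-index-unique : ∀ {μ i₁ i₂ e} → lab μ i₁ ≡ real e → lab μ i₂ ≡ real e → i₁ ≡ i₂
  real-index-unique {μ} {i₁} {i₂} {e} l₁ l₂ =
    ,-injectiveʳ-UIP (Decidable⇒UIP.≡-irrelevant _≟_) (ExactlyOne-unique (real-unique e) l₁ l₂)

  child-descendant : ∀ {μ i ν x} → lab μ i ≡ down ν → Descendant x ν → Descendant x μ
  child-descendant {μ} {i} {ν} li d with down-child μ i ν li
  ... | _ , refl = descendant-par d

  parent-not-below-child : ∀ {μ i ν} → lab μ i ≡ down ν → ¬ Descendant μ ν
  parent-not-below-child {μ} {i} {ν} li with down-child μ i ν li
  ... | ν≢root , refl = par-not-descendant ν≢root

  -- Decreases from a node to each child, so recursion may descend the tree.
  nodesOfRank≥ : Fin N → ℕ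
  nodesOfRank≥ ν = countF (λ x → ⌊ rank ν ℕ.≤? rank x ⌋)

  nodesOfRank≥-child : ∀ {ν ν′} → rank ν < rank ν′ → nodesOfRank≥ ν′ < nodesOfRank≥ ν
  nodesOfRank≥-child {ν} {ν′} ν<ν′ =
    countF-< (λ x h → fromWitness (≤-trans (<⇒≤ ν<ν′) (toWitness h))) ν
             (fromWitness ≤-refl) (λ h → <-irrefl refl (<-≤-trans ν<ν′ (toWitness h)))

  another-edge : ∀ μ {j a} → IsVirtual (lab μ j) → a ∈ₚ ends μ j → ∃ λ i → i ≢ j × a ∈ₚ ends μ i
  another-edge μ j-virtual a∈j with skeleton-others (kind μ) (skel-ok μ) j-virtual a∈j
  ... | f , _ , others = f (firstOther (kind μ)) , others (firstOther (kind μ))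

  pertinent-edge-at-pole : ∀ {a} ν → Acc _<_ (nodesOfRank≥ ν) → IsPole 𝒯 ν a
                         → ∃ λ e → T (incident G a e) × Descendant (home 𝒯 e) ν
  pertinent-edge-at-pole {a} ν (acc rs) (j , lj , a∈j) with another-edge ν (up-virtual lj) a∈j
  ... | i , i≢j , a∈i with lab ν i in li
  ... | real e = e , ∈ₚ⇒incident G e (∈ₚ-resp-≈ₚ a∈i (real-ends ν i e li)) , 0 , home-real li
  ... | up     = ⊥-elim (i≢j (up-index-unique li lj))
  ... | down ν′ with down-child ν i ν′ li
  ... | ν′≢root , refl with up-unique ν′ ν′≢root
  ... | j′ , lj′ , _ with pertinent-edge-at-pole ν′ (rs (nodesOfRank≥-child (rank-par ν′ ν′≢root)))
                            (j′ , lj′ , ∈ₚ-resp-≈ₚ a∈i (twin ν′ i j′ li lj′))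
  ... | e , e-at-a , e-below = e , e-at-a , descendant-par e-below

  -- The edges of G that a skeleton edge of μ stands for.
  Region : Fin N → Label N m → Fin m → Set
  Region μ (real e′) e = e ≡ e′
  Region μ up        e = ¬ Descendant (home 𝒯 e) μ
  Region μ (down ν)  e = Descendant (home 𝒯 e) ν

  regions-disjoint : ∀ μ {i₁ i₂ e} l₁ l₂ → lab μ i₁ ≡ l₁ → lab μ i₂ ≡ l₂
                   → Region μ l₁ e → Region μ l₂ e → i₁ ≡ i₂
  regions-disjoint μ (real _) (real _)  l₁ l₂ refl refl = real-index-unique l₁ l₂
  regions-disjoint μ (real _) up        l₁ _  refl r₂   = ⊥-elim (r₂ (0 , home-real l₁))
  regions-disjoint μ (real _) (down _)  l₁ l₂ refl r₂   =
    ⊥-elim (parent-not-below-child l₂ (subst (λ z → Descendant z _) (home-real l₁) r₂))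
  regions-disjoint μ up       (real _)  _  l₂ r₁ refl   = ⊥-elim (r₁ (0 , home-real l₂))
  regions-disjoint μ up       up        l₁ l₂ _  _      = up-index-unique l₁ l₂
  regions-disjoint μ up       (down _)  _  l₂ r₁ r₂     = ⊥-elim (r₁ (child-descendant l₂ r₂))
  regions-disjoint μ (down _) (real _)  l₁ l₂ r₁ refl   =
    ⊥-elim (parent-not-below-child l₁ (subst (λ z → Descendant z _) (home-real l₂) r₁))
  regions-disjoint μ (down _) up        l₁ _  r₁ r₂     = ⊥-elim (r₂ (child-descendant l₁ r₁))
  regions-disjoint μ (down ν₁) (down ν₂) l₁ l₂ r₁ r₂ with ν₁ ≟ ν₂
  ... | yes refl  = down-index-unique l₁ l₂
  ... | no ν₁≢ν₂ with down-child μ _ ν₁ l₁ | down-child μ _ ν₂ l₂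
  ... | ν₁≢root , p₁ | ν₂≢root , p₂ =
    ⊥-elim (siblings-disjoint ν₁≢root ν₂≢root (trans p₁ (sym p₂)) ν₁≢ν₂ r₁ r₂)

  OutsideEdgesAt : Fin N → Fin n → ℕ → Set
  OutsideEdgesAt ν a c = Σ (Fin c → Fin m) λ g → Inj g
                       × (∀ t → T (incident G a (g t)) × ¬ Descendant (home 𝒯 (g t)) ν)

  mutual
    region-edge : ∀ {a} μ → Acc _<_ (rank μ) → (i : Fin (ec μ)) → a ∈ₚ ends μ i
                → ∃ λ e → T (incident G a e) × Region μ (lab μ i) e
    region-edge μ rec i a∈i with lab μ i in li
    ... | real e = e , ∈ₚ⇒incident G e (∈ₚ-resp-≈ₚ a∈i (real-ends μ i e li)) , refl
    region-edge μ rec i a∈i | up with outside-edges μ rec (up-not-root li) (i , li , a∈i)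
    ... | g , _ , g-out = g (firstOther _) , g-out (firstOther _)
    region-edge μ rec i a∈i | down ν with down-child μ i ν li
    ... | ν≢root , refl with up-unique ν ν≢root
    ... | j , lj , _ =
      pertinent-edge-at-pole ν (<-wellFounded _) (j , lj , ∈ₚ-resp-≈ₚ a∈i (twin ν i j li lj))

    outside-edges : ∀ {a} ν → Acc _<_ (rank ν) → ν ≢ root → IsPole 𝒯 ν a
                  → OutsideEdgesAt ν a (otherEdgesAtPole (kind (par ν)))
    outside-edges {a} ν (acc rs) ν≢root (j , lj , a∈j) with down-unique ν ν≢root
    ... | i₀ , li₀ , _ with skeleton-others (kind (par ν)) (skel-ok (par ν)) (down-virtual li₀)
                                            (∈ₚ-resp-≈ₚ a∈j (≈ₚ-sym (twin ν i₀ j li₀ lj)))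
    ... | f , f-inj , others = g , g-inj , g-out
      where
      edge : ∀ t → ∃ λ e → T (incident G a e) × Region (par ν) (lab (par ν) (f t)) e
      edge t = region-edge (par ν) (rs (rank-par ν ν≢root)) (f t) (proj₂ (others t))
      g : Fin _ → Fin m
      g t = proj₁ (edge t)
      region : ∀ t → Region (par ν) (lab (par ν) (f t)) (g t)
      region t = proj₂ (proj₂ (edge t))
      g-inj : Inj g
      g-inj t₁ t₂ same = f-inj t₁ t₂ (regions-disjoint (par ν) _ _ refl refl (region t₁)
                                        (subst (Region (par ν) (lab (par ν) (f t₂))) (sym same) (region t₂)))
      g-out : ∀ t → T (incident G a (g t)) × ¬ Descendant (home 𝒯 (g t)) ν
      g-out t = proj₁ (proj₂ (edge t)) , proj₁ (others t) ∘ regions-disjoint (par ν) _ _ refl li₀ (region t)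

lemma1 : ∀ {n m : ℕ} (G : Fin m → Pair n) (k : ℕ)
    → SimpleEdges G → Biconnected G → KPlanar k G
    → (T : SPQRTree G) → SPQRTree.kind T (SPQRTree.root T) ≡ Q
    → (μ : Fin (SPQRTree.N T)) → μ ≢ SPQRTree.root T
    → (v : Fin n) → IsPole T μ v
    → degIn G (inPert T μ) v ≤ poleBound k (SPQRTree.kind T (SPQRTree.par T μ))
lemma1 G k _ _ (_ , deg≤k) 𝒯 _ μ μ≢root v pole
  with outside-edges 𝒯 μ (<-wellFounded _) μ≢root pole
... | g , g-inj , g-out =
  subst (degIn G (inPert 𝒯 μ) v ≤_) (sym (poleBound≡∸ k (SPQRTree.kind 𝒯 (SPQRTree.par 𝒯 μ))))
    (m+n≤o⇒m≤o∸n _ (≤-trans (degIn-+-outside G (inPert 𝒯 μ) v g g-inj outside) (deg≤k v)))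
  where
  outside : ∀ t → T (incident G v (g t)) × ¬ T (inPert 𝒯 μ (g t))
  outside t = proj₁ (g-out t) , proj₂ (g-out t) ∘ inPert-sound 𝒯 μ (g t)
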